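{- Let $m$ be an odd positive integer, let $f:\mathbb{Z}_m\to\{\pm1,\pm\mathrm{i}\}$ be a quaternary sequence, and let $\phi:\mathbb{Z}_2\times\mathbb{Z}_m\to\{\pm1\}$ be given by $\phi(0,k)=\mathrm{Re}(f(k))-\mathrm{Im}(f(k))$, $\phi(1,k)=\mathrm{Re}(f(k))+\mathrm{Im}(f(k))$. Then $f$ is an OQS if and only if the sets $B=\{j\in\mathbb{Z}_m : \phi(0,j)=-1\}$ and $D=\{j\in\mathbb{Z}_m:\phi(1,j)=-1\}$ are $2$-$\{m;|B|,|D|;|B|+|D|-\frac{m+1}{2}\}$ ASDS such that the multiset $B-D=\{x-y \bmod m : (x,y)\in B\times D\}$ is symmetric, i.e. closed under negation (each $w\in\mathbb{Z}_m$ occurs in it with the same multiplicity as $-w$).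
   Context: $\mathrm{i}=\sqrt{ -1}$. For $f:\mathbb{Z}_m\to\mathbb{C}$, $R_f(w)=\sum_{k\in\mathbb{Z}_m}f(k)\overline{f(k+w)}$. A quaternary sequence $f$ of odd length $m$ is an OQS (optimal quaternary sequence) if $|R_f(w)|=1$ for all $1\le w\le m-1$. Almost supplementary difference sets: for subsets $B,D\subseteq\mathbb{Z}_m$ and $a\in\mathbb{Z}_m$ let $N(a)=|\{(x,x')\in B\times B: x-x'\equiv a\}|+|\{(y,y')\in D\times D: y-y'\equiv a\}|$. For integers $k_1,k_2,\mu$, the sets $B,D$ are $2$-$\{m;k_1,k_2;\mu\}$ ASDS if $|B|=k_1$, $|D|=k_2$ and $N(a)\in\{\mu,\mu+1\}$ for every $a\in\mathbb{Z}_m\setminus\{0\}$. -}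

module Defs where

open import Data.Nat as ℕ using (ℕ; NonZero)
open import Data.Nat.DivMod using (_%_; _mod_)
open import Data.Integer as ℤ using (ℤ; +_; -_)
open import Data.Fin as Fin using (Fin; toℕ)
open import Data.Fin.Subset using (Subset; _∈_; ∣_∣)
open import Data.Fin.Subset.Properties using (_∈?_)
open import Data.List using (List; []; _∷_; foldr; map; allFin; cartesianProduct; filterᵇ; length)
open import Data.Vec using (tabulate)
open import Data.Bool using (Bool; _∧_)
open import Data.Product using (_×_; _,_)
open import Data.Sum using (_⊎_)
open import Relation.Nullary using (does; ¬_)
open import Relation.Binary.PropositionalEquality using (_≡_)

-- Gaussian integers (the values of R_f lie in ℤ[i])

record ℤi : Set where
  constructor _+i_
  field
    re : ℤ
    im : ℤ
open ℤi public

_⊞_ : ℤi → ℤi → ℤi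
(a +i b) ⊞ (c +i d) = (a ℤ.+ c) +i (b ℤ.+ d)

_⊠_ : ℤi → ℤi → ℤi
(a +i b) ⊠ (c +i d) = ((a ℤ.* c) ℤ.- (b ℤ.* d)) +i ((a ℤ.* d) ℤ.+ (b ℤ.* c))

conj : ℤi → ℤi
conj (a +i b) = a +i (- b)

normSq : ℤi → ℤ
normSq (a +i b) = (a ℤ.* a) ℤ.+ (b ℤ.* b)

data Q4 : Set where
  q1 qi q-1 q-i : Q4

val : Q4 → ℤi
val q1  = (+ 1) +i (+ 0)
val qi  = (+ 0) +i (+ 1)
val q-1 = (- (+ 1)) +i (+ 0)
val q-i = (+ 0) +i (- (+ 1))

module _ (m : ℕ) .{{_ : NonZero m}} where

  _⊕_ : Fin m → Fin m → Fin m
  x ⊕ y = (toℕ x ℕ.+ toℕ y) mod m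

  ⊖_ : Fin m → Fin m
  ⊖ x = (m ℕ.∸ toℕ x) mod m

  _⊝_ : Fin m → Fin m → Fin m
  x ⊝ y = (toℕ x ℕ.+ (m ℕ.∸ toℕ y)) mod m

  0m : Fin m
  0m = 0 mod m

  sumℤi : (Fin m → ℤi) → ℤi
  sumℤi g = foldr (λ k acc → g k ⊞ acc) ((+ 0) +i (+ 0)) (allFin m)

  R : (Fin m → Q4) → Fin m → ℤi
  R f w = sumℤi (λ k → val (f k) ⊠ conj (val (f (k ⊕ w))))

  -- optimal quaternary sequence: |R_f(w)| = 1 for all w ≠ 0
  -- (|z| = 1 iff |z|^2 = 1)
  OQS : (Fin m → Q4) → Set
  OQS f = (w : Fin m) → ¬ (w ≡ 0m) → normSq (R f w) ≡ + 1

  pairDiffCount : Subset m → Subset m → Fin m → ℕ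
  pairDiffCount S T a =
    length (filterᵇ
      (λ { (x , y) → does (x ∈? S) ∧ does (y ∈? T) ∧ does ((x ⊝ y) Fin.≟ a) })
      (cartesianProduct (allFin m) (allFin m)))

  N : Subset m → Subset m → Fin m → ℕ
  N B D a = pairDiffCount B B a ℕ.+ pairDiffCount D D a

  ASDS : Subset m → Subset m → ℕ → ℕ → ℤ → Set
  ASDS B D k₁ k₂ μ =
    (∣ B ∣ ≡ k₁) × (∣ D ∣ ≡ k₂) ×
    ((a : Fin m) → ¬ (a ≡ 0m) → (+ N B D a ≡ μ) ⊎ (+ N B D a ≡ μ ℤ.+ + 1))

  SymmetricDiff : Subset m → Subset m → Set
  SymmetricDiff B D = (w : Fin m) → pairDiffCount B D w ≡ pairDiffCount B D (⊖ w)

  φ : (Fin m → Q4) → Fin 2 → Fin m → ℤ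
  φ f Fin.zero k = re (val (f k)) ℤ.- im (val (f k))
  φ f (Fin.suc _) k = re (val (f k)) ℤ.+ im (val (f k))

  Bset : (Fin m → Q4) → Subset m
  Bset f = tabulate (λ j → does (φ f Fin.zero j ℤ.≟ - (+ 1)))

  Dset : (Fin m → Q4) → Subset m
  Dset f = tabulate (λ j → does (φ f (Fin.suc Fin.zero) j ℤ.≟ - (+ 1)))

module Submission where

-- Write β, δ for the indicators of B, D along f; on the alphabet, f(k) = (1 - β_k - δ_k) + (β_k - δ_k) i.
-- With primes for the shift k ↦ k + w and Iverson brackets,
--   Re f(k) conj f(k + w) = [β = β'] + [δ = δ'] - 1,   Im f(k) conj f(k + w) = [δ = β'] - [β = δ'],
-- and summing over k turns these agreement counts into difference counts: for odd m,
--   R_f(w) = (2t - 1) + 2u i   with   t = N(w) - μ,   u = #{B - D ∋ w} - #{B - D ∋ -w}.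
-- As |R_f(w)|^2 = 1 + 4 (t (t - 1) + u^2) where t (t - 1) and u^2 are natural numbers,
-- |R_f(w)| = 1 exactly when t ∈ {0, 1} and u = 0.

open import Defs
open import Data.Nat using (ℕ; NonZero)
open import Data.Fin using (Fin)

module IntegerSums where

  open import Data.Integer.Properties using (+-*-semiring; *-identityˡ; +-identityˡ; +-identityʳ)
  open import Algebra.Properties.Semiring.Sum +-*-semiring public
    using (sum; sum-cong-≗; sum-replicate-zero; ∑-distrib-+; ∑-comm; ∑-permute)
  open import Data.Bool using (Bool; true; false; _∧_)
  open import Data.Fin using (Fin; zero; suc)
  open import Data.Fin.Properties using (_≟_)
  open import Data.Integer using (ℤ; +_; _+_; _-_; _*_)
  open import Data.Integer.Tactic.RingSolver using (solve-∀)
  open import Data.Nat using (zero; suc)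
  open import Function using (_∘_)
  open import Relation.Binary.PropositionalEquality
  open import Relation.Nullary using (does)

  ⟦_⟧ : Bool → ℤ
  ⟦ true ⟧ = + 1
  ⟦ false ⟧ = + 0

  ⟦∧⟧ : ∀ a b → ⟦ a ∧ b ⟧ ≡ ⟦ a ⟧ * ⟦ b ⟧
  ⟦∧⟧ true true = refl
  ⟦∧⟧ true false = refl
  ⟦∧⟧ false b = refl

  ∑-select : ∀ {n} (c : Fin n) (g : Fin n → ℤ) → sum (λ x → ⟦ does (x ≟ c) ⟧ * g x) ≡ g c
  ∑-select {suc n} zero g = begin
    + 1 * g zero + sum {n} (λ _ → + 0) ≡⟨ cong₂ _+_ (*-identityˡ (g zero)) (sum-replicate-zero n) ⟩
    g zero + + 0                       ≡⟨ +-identityʳ (g zero) ⟩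
    g zero                             ∎
    where open ≡-Reasoning
  ∑-select (suc c) g = trans (+-identityˡ _) (∑-select c (g ∘ suc))

  sum-const : ∀ n (c : ℤ) → sum {n} (λ _ → c) ≡ + n * c
  sum-const zero c = refl
  sum-const (suc n) c = trans (cong (_+_ c) (sum-const n c)) (distrib c (+ n))
    where
    distrib : ∀ c n → c + n * c ≡ (+ 1 + n) * c
    distrib = solve-∀

  ∑[g-h]≡∑g-∑h : ∀ {n} (g h : Fin n → ℤ) → sum (λ k → g k - h k) ≡ sum g - sum h
  ∑[g-h]≡∑g-∑h {zero} g h = refl
  ∑[g-h]≡∑g-∑h {suc n} g h =
    trans (cong (_+_ (g zero - h zero)) (∑[g-h]≡∑g-∑h (g ∘ suc) (h ∘ suc)))
          (interchange (g zero) (h zero) (sum (g ∘ suc)) (sum (h ∘ suc)))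
    where
    interchange : ∀ a b c d → a - b + (c - d) ≡ a + c - (b + d)
    interchange = solve-∀

  -- On {0, 1}, agree a b is the indicator of a = b.
  agree : ℤ → ℤ → ℤ
  agree a b = + 1 - a - b + + 2 * (a * b)

  ∑-agree : ∀ {n} (a b : Fin n → ℤ) →
    sum (λ k → agree (a k) (b k)) ≡ + n - sum a - sum b + + 2 * sum (λ k → a k * b k)
  ∑-agree {zero} a b = refl
  ∑-agree {suc n} a b =
    trans (cong (_+_ (agree (a zero) (b zero))) (∑-agree (a ∘ suc) (b ∘ suc)))
          (regroup (a zero) (b zero) (+ n) (sum (a ∘ suc)) (sum (b ∘ suc)) _)
    where
    regroup : ∀ a b n sa sb sab →
      (+ 1 - a - b + + 2 * (a * b)) + (n - sa - sb + + 2 * sab)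
        ≡ + 1 + n - (a + sa) - (b + sb) + + 2 * (a * b + sab)
    regroup = solve-∀

module Counting where

  open IntegerSums
  open import Data.Bool using (Bool; true; false; T?)
  open import Data.Fin using (Fin; zero; suc)
  open import Data.Fin.Subset using (∣_∣)
  open import Data.Fin.Subset.Properties using (_∈?_)
  open import Data.Integer using (+_; _+_)
  open import Data.Integer.Properties using (+-identityˡ)
  open import Data.List using (List; _++_; filterᵇ; length; tabulate; map; cartesianProduct)
  open import Data.List.Properties using (filter-++; length-++; map-tabulate)
  open import Data.Nat using (zero; suc)
  open import Data.Product using (_×_; _,_)
  import Data.Vec as Vec
  open import Function using (_∘_)
  open import Relation.Binary.PropositionalEquality
  open import Relation.Nullary using (does)

  count-++ : ∀ {A : Set} (p : A → Bool) (xs ys : List A) →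
    + length (filterᵇ p (xs ++ ys)) ≡ + length (filterᵇ p xs) + + length (filterᵇ p ys)
  count-++ p xs ys =
    cong +_ (trans (cong length (filter-++ (T? ∘ p) xs ys)) (length-++ (filterᵇ p xs)))

  count-tabulate : ∀ {A : Set} {n} (p : A → Bool) (g : Fin n → A) →
    + length (filterᵇ p (tabulate g)) ≡ sum (λ i → ⟦ p (g i) ⟧)
  count-tabulate {n = zero} p g = refl
  count-tabulate {n = suc n} p g with p (g zero)
  ... | true = cong (_+_ (+ 1)) (count-tabulate p (g ∘ suc))
  ... | false = trans (count-tabulate p (g ∘ suc)) (sym (+-identityˡ _))

  count-cartesianProduct : ∀ {A B : Set} {n k} (p : A × B → Bool) (g : Fin n → A) (h : Fin k → B) →
    + length (filterᵇ p (cartesianProduct (tabulate g) (tabulate h)))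
      ≡ sum (λ i → sum (λ j → ⟦ p (g i , h j) ⟧))
  count-cartesianProduct {n = zero} p g h = refl
  count-cartesianProduct {n = suc n} p g h =
    trans (count-++ p (map (g zero ,_) (tabulate h)) _)
          (cong₂ _+_ (trans (cong (+_ ∘ length ∘ filterᵇ p) (map-tabulate h (g zero ,_)))
                            (count-tabulate p (λ j → g zero , h j)))
                     (count-cartesianProduct p (g ∘ suc) h))

  ∈?-tabulate : ∀ {n} (b : Fin n → Bool) (x : Fin n) → does (x ∈? Vec.tabulate b) ≡ b x
  ∈?-tabulate b zero with b zero
  ... | true = refl
  ... | false = refl
  ∈?-tabulate b (suc x) = ∈?-tabulate (b ∘ suc) x

  ∣tabulate∣ : ∀ {n} (b : Fin n → Bool) → + ∣ Vec.tabulate b ∣ ≡ sum (⟦_⟧ ∘ b)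
  ∣tabulate∣ {zero} b = refl
  ∣tabulate∣ {suc n} b with b zero
  ... | true = cong (_+_ (+ 1)) (∣tabulate∣ (b ∘ suc))
  ... | false = trans (∣tabulate∣ (b ∘ suc)) (sym (+-identityˡ _))

module Residues (m : ℕ) .{{_ : NonZero m}} where

  open IntegerSums
  open Counting
  open import Data.Bool using (Bool; _∧_)
  open import Data.Fin using (Fin; toℕ)
  open import Data.Fin.Permutation using (Permutation; permutation)
  open import Data.Fin.Properties using (_≟_; toℕ-fromℕ<; fromℕ<-cong; fromℕ<-toℕ; toℕ<n)
  open import Data.Fin.Subset using (∣_∣)
  open import Data.Fin.Subset.Properties using (_∈?_)
  open import Data.Integer using (ℤ; +_; _+_; _-_; _*_)
  open import Data.Integer.Properties using (*-comm)
  open import Data.Integer.Tactic.RingSolver using (solve-∀)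
  open import Data.Nat as ℕ using (_∸_)
  open import Data.Nat.DivMod
    using (_%_; _mod_; %-distribˡ-+; m%n%n≡m%n; [m+n]%n≡m%n; m%n<n; n%n≡0; m*n%n≡0; m<n⇒m%n≡m)
  open import Data.Nat.Properties using (+-comm; +-assoc; m+[n∸m]≡n; m∸n+n≡m; <⇒≤)
  import Data.Vec as Vec
  open import Function using (_∘_; id; _⇔_; mk⇔)
  open import Relation.Binary.PropositionalEquality
  open import Relation.Nullary using (does)
  open import Relation.Nullary.Decidable using (does-⇔)

  infixl 6 _+ₘ_ _-ₘ_
  _+ₘ_ _-ₘ_ : Fin m → Fin m → Fin m
  _+ₘ_ = _⊕_ m
  _-ₘ_ = _⊝_ m

  -ₘ_ : Fin m → Fin m
  -ₘ_ = ⊖_ m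

  toℕ-mod : ∀ n → toℕ (n mod m) ≡ n % m
  toℕ-mod n = toℕ-fromℕ< (m%n<n n m)

  mod-cong : ∀ {a b} → a % m ≡ b % m → a mod m ≡ b mod m
  mod-cong eq = fromℕ<-cong _ _ eq _ _

  toℕ-mod-≡ : ∀ n (x : Fin m) → n % m ≡ toℕ x % m → n mod m ≡ x
  toℕ-mod-≡ n x eq =
    trans (mod-cong eq) (trans (fromℕ<-cong _ _ (m<n⇒m%n≡m (toℕ<n x)) _ (toℕ<n x)) (fromℕ<-toℕ x _))

  [a%m+b]%m≡[a+b]%m : ∀ a b → (a % m ℕ.+ b) % m ≡ (a ℕ.+ b) % m
  [a%m+b]%m≡[a+b]%m a b = begin
    (a % m ℕ.+ b) % m           ≡⟨ %-distribˡ-+ (a % m) b m ⟩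
    (a % m % m ℕ.+ b % m) % m   ≡⟨ cong (λ z → (z ℕ.+ b % m) % m) (m%n%n≡m%n a m) ⟩
    (a % m ℕ.+ b % m) % m       ≡⟨ %-distribˡ-+ a b m ⟨
    (a ℕ.+ b) % m               ∎
    where open ≡-Reasoning

  [[n+a]%m+b]%m≡n%m : ∀ n {a b} → a ℕ.+ b ≡ m → ((n ℕ.+ a) % m ℕ.+ b) % m ≡ n % m
  [[n+a]%m+b]%m≡n%m n {a} {b} a+b≡m = begin
    ((n ℕ.+ a) % m ℕ.+ b) % m   ≡⟨ [a%m+b]%m≡[a+b]%m (n ℕ.+ a) b ⟩
    (n ℕ.+ a ℕ.+ b) % m         ≡⟨ cong (_% m) (trans (+-assoc n a b) (cong (n ℕ.+_) a+b≡m)) ⟩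
    (n ℕ.+ m) % m               ≡⟨ [m+n]%n≡m%n n m ⟩
    n % m                       ∎
    where open ≡-Reasoning

  +ₘ-comm : ∀ x y → x +ₘ y ≡ y +ₘ x
  +ₘ-comm x y = cong (_mod m) (+-comm (toℕ x) (toℕ y))

  [x+w]-w≡x : ∀ x w → (x +ₘ w) -ₘ w ≡ x
  [x+w]-w≡x x w = toℕ-mod-≡ _ x
    (trans (cong (λ z → (z ℕ.+ (m ∸ toℕ w)) % m) (toℕ-mod _))
           ([[n+a]%m+b]%m≡n%m (toℕ x) (m+[n∸m]≡n (<⇒≤ (toℕ<n w)))))

  [x-w]+w≡x : ∀ x w → (x -ₘ w) +ₘ w ≡ x
  [x-w]+w≡x x w = toℕ-mod-≡ _ x
    (trans (cong (λ z → (z ℕ.+ toℕ w) % m) (toℕ-mod _))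
           ([[n+a]%m+b]%m≡n%m (toℕ x) (m∸n+n≡m (<⇒≤ (toℕ<n w)))))

  x+[-w]≡x-w : ∀ x w → x +ₘ (-ₘ w) ≡ x -ₘ w
  x+[-w]≡x-w x w = mod-cong (begin
    (toℕ x ℕ.+ toℕ (-ₘ w)) % m       ≡⟨ cong (λ z → (toℕ x ℕ.+ z) % m) (toℕ-mod _) ⟩
    (toℕ x ℕ.+ (m ∸ toℕ w) % m) % m  ≡⟨ cong (_% m) (+-comm (toℕ x) _) ⟩
    ((m ∸ toℕ w) % m ℕ.+ toℕ x) % m  ≡⟨ [a%m+b]%m≡[a+b]%m (m ∸ toℕ w) (toℕ x) ⟩
    ((m ∸ toℕ w) ℕ.+ toℕ x) % m      ≡⟨ cong (_% m) (+-comm _ (toℕ x)) ⟩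
    (toℕ x ℕ.+ (m ∸ toℕ w)) % m      ∎)
    where open ≡-Reasoning

  -0≡0 : -ₘ 0m m ≡ 0m m
  -0≡0 = mod-cong (begin
    (m ∸ toℕ (0m m)) % m ≡⟨ cong (λ z → (m ∸ z) % m) (trans (toℕ-mod 0) 0%m≡0) ⟩
    m % m                ≡⟨ n%n≡0 m ⟩
    0                    ≡⟨ 0%m≡0 ⟨
    0 % m                ∎)
    where
    open ≡-Reasoning
    0%m≡0 : 0 % m ≡ 0
    0%m≡0 = m*n%n≡0 0 m

  x-y≡a⇔x≡y+a : ∀ {x y a} → x -ₘ y ≡ a ⇔ x ≡ y +ₘ a
  x-y≡a⇔x≡y+a {x} {y} {a} = mk⇔
    (λ { refl → trans (sym ([x-w]+w≡x x y)) (+ₘ-comm _ y) })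
    (λ { refl → trans (cong (_-ₘ y) (+ₘ-comm y a)) ([x+w]-w≡x a y) })

  translation : Fin m → Permutation m m
  translation w = permutation (_+ₘ w) (_-ₘ w) (λ x → [x-w]+w≡x x w) (λ x → [x+w]-w≡x x w)

  ∑-translate : ∀ w (g : Fin m → ℤ) → sum (λ k → g (k +ₘ w)) ≡ sum g
  ∑-translate w g = sym (∑-permute g (translation w))

  correlation : (s t : Fin m → Bool) → Fin m → ℤ
  correlation s t w = sum (λ k → ⟦ s k ⟧ * ⟦ t (k +ₘ w) ⟧)

  pairDiffCount-tabulate : ∀ (s t : Fin m → Bool) a →
    + pairDiffCount m (Vec.tabulate s) (Vec.tabulate t) a ≡ correlation t s a
  pairDiffCount-tabulate s t a = begin
    + pairDiffCount m (Vec.tabulate s) (Vec.tabulate t) a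
      ≡⟨ count-cartesianProduct {n = m} {k = m} _ id id ⟩
    sum (λ x → sum (λ y →
      ⟦ does (x ∈? Vec.tabulate s) ∧ does (y ∈? Vec.tabulate t) ∧ does (x -ₘ y ≟ a) ⟧))
      ≡⟨ sum-cong-≗ (λ x → sum-cong-≗ (pointwise x)) ⟩
    sum (λ x → sum (λ y → ⟦ does (x ≟ y +ₘ a) ⟧ * (⟦ t y ⟧ * ⟦ s x ⟧)))
      ≡⟨ ∑-comm (λ x y → ⟦ does (x ≟ y +ₘ a) ⟧ * (⟦ t y ⟧ * ⟦ s x ⟧)) ⟩
    sum (λ y → sum (λ x → ⟦ does (x ≟ y +ₘ a) ⟧ * (⟦ t y ⟧ * ⟦ s x ⟧)))
      ≡⟨ sum-cong-≗ (λ y → ∑-select (y +ₘ a) (λ x → ⟦ t y ⟧ * ⟦ s x ⟧)) ⟩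
    correlation t s a ∎
    where
    open ≡-Reasoning
    rotate : ∀ a b c → a * (b * c) ≡ c * (b * a)
    rotate = solve-∀
    pointwise : ∀ x y →
      ⟦ does (x ∈? Vec.tabulate s) ∧ does (y ∈? Vec.tabulate t) ∧ does (x -ₘ y ≟ a) ⟧
        ≡ ⟦ does (x ≟ y +ₘ a) ⟧ * (⟦ t y ⟧ * ⟦ s x ⟧)
    pointwise x y
      rewrite ∈?-tabulate s x | ∈?-tabulate t y
            | ⟦∧⟧ (s x) (t y ∧ does (x -ₘ y ≟ a)) | ⟦∧⟧ (t y) (does (x -ₘ y ≟ a))
            | does-⇔ x-y≡a⇔x≡y+a (x -ₘ y ≟ a) (x ≟ y +ₘ a)
      = rotate ⟦ s x ⟧ ⟦ t y ⟧ _

  correlation-neg : ∀ s t w → correlation t s (-ₘ w) ≡ correlation s t w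
  correlation-neg s t w = begin
    sum (λ k → ⟦ t k ⟧ * ⟦ s (k +ₘ -ₘ w) ⟧)
      ≡⟨ ∑-translate w (λ k → ⟦ t k ⟧ * ⟦ s (k +ₘ -ₘ w) ⟧) ⟨
    sum (λ k → ⟦ t (k +ₘ w) ⟧ * ⟦ s (k +ₘ w +ₘ -ₘ w) ⟧)
      ≡⟨ sum-cong-≗ (λ k → cong (λ x → ⟦ t (k +ₘ w) ⟧ * ⟦ s x ⟧)
                                (trans (x+[-w]≡x-w _ w) ([x+w]-w≡x k w))) ⟩
    sum (λ k → ⟦ t (k +ₘ w) ⟧ * ⟦ s k ⟧)
      ≡⟨ sum-cong-≗ (λ k → *-comm ⟦ t (k +ₘ w) ⟧ ⟦ s k ⟧) ⟩
    correlation s t w ∎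
    where open ≡-Reasoning

  ∑-agree-translate : ∀ (s t : Fin m → Bool) w →
    sum (λ k → agree ⟦ s k ⟧ ⟦ t (k +ₘ w) ⟧)
      ≡ + m - + ∣ Vec.tabulate s ∣ - + ∣ Vec.tabulate t ∣ + + 2 * correlation s t w
  ∑-agree-translate s t w = begin
    sum (λ k → agree ⟦ s k ⟧ ⟦ t (k +ₘ w) ⟧)
      ≡⟨ ∑-agree (⟦_⟧ ∘ s) (⟦_⟧ ∘ t ∘ (_+ₘ w)) ⟩
    + m - sum (⟦_⟧ ∘ s) - sum (⟦_⟧ ∘ t ∘ (_+ₘ w)) + + 2 * correlation s t w
      ≡⟨ cong₂ (λ σ τ → + m - σ - τ + + 2 * correlation s t w)
               (sym (∣tabulate∣ s)) (trans (∑-translate w (⟦_⟧ ∘ t)) (sym (∣tabulate∣ t))) ⟩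
    + m - + ∣ Vec.tabulate s ∣ - + ∣ Vec.tabulate t ∣ + + 2 * correlation s t w ∎
    where open ≡-Reasoning

module GaussianIntegers where

  open IntegerSums using (sum)
  open import Data.Fin using (Fin; zero; suc)
  open import Data.Integer using (ℤ; +_; -[1+_]; ∣_∣; _+_; _-_; _*_)
  open import Data.Integer.Properties using (+◃n≡+n; pos-*; +-injective; ∣i∣≡0⇒i≡0)
  open import Data.Integer.Tactic.RingSolver using (solve-∀)
  open import Data.List using (foldr; tabulate)
  open import Data.Nat as ℕ using (ℕ; zero; suc; _∸_)
  open import Data.Nat.Properties
    using (+-identityʳ; suc-injective; m*n≡0⇒m≡0∨n≡0; m+n≡0⇒m≡0; m+n≡0⇒n≡0)
  open import Data.Product using (_×_; _,_)
  open import Data.Sum using (_⊎_; inj₁; inj₂)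
  open import Function using (_∘_; _⇔_; mk⇔)
  open import Relation.Binary.PropositionalEquality

  re-foldr-⊞ : ∀ {A : Set} {n} (g : A → ℤi) (h : Fin n → A) →
    re (foldr (λ k acc → g k ⊞ acc) ((+ 0) +i (+ 0)) (tabulate h)) ≡ sum (λ i → re (g (h i)))
  re-foldr-⊞ {n = zero} g h = refl
  re-foldr-⊞ {n = suc n} g h = cong (_+_ (re (g (h zero)))) (re-foldr-⊞ g (h ∘ suc))

  im-foldr-⊞ : ∀ {A : Set} {n} (g : A → ℤi) (h : Fin n → A) →
    im (foldr (λ k acc → g k ⊞ acc) ((+ 0) +i (+ 0)) (tabulate h)) ≡ sum (λ i → im (g (h i)))
  im-foldr-⊞ {n = zero} g h = refl
  im-foldr-⊞ {n = suc n} g h = cong (_+_ (im (g (h zero)))) (im-foldr-⊞ g (h ∘ suc))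

  pronic : ℤ → ℕ
  pronic (+ n) = n ℕ.* (n ∸ 1)
  pronic -[1+ n ] = suc n ℕ.* suc (suc n)

  t[t-1]≡pronic : ∀ t → t * (t - + 1) ≡ + pronic t
  t[t-1]≡pronic (+ zero) = refl
  t[t-1]≡pronic (+ suc n) = +◃n≡+n (suc n ℕ.* n)
  t[t-1]≡pronic -[1+ n ] = cong (λ k → + (suc n ℕ.* suc (suc k))) (+-identityʳ n)

  pronic≡0⇒ : ∀ t → pronic t ≡ 0 → t ≡ + 0 ⊎ t ≡ + 1
  pronic≡0⇒ (+ 0) _ = inj₁ refl
  pronic≡0⇒ (+ 1) _ = inj₂ refl
  pronic≡0⇒ (+ suc (suc n)) ()
  pronic≡0⇒ -[1+ n ] ()

  u*u≡∣u∣*∣u∣ : ∀ u → u * u ≡ + (∣ u ∣ ℕ.* ∣ u ∣)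
  u*u≡∣u∣*∣u∣ (+ n) = +◃n≡+n (n ℕ.* n)
  u*u≡∣u∣*∣u∣ -[1+ n ] = refl

  ∣u∣*∣u∣≡0⇒ : ∀ u → ∣ u ∣ ℕ.* ∣ u ∣ ≡ 0 → u ≡ + 0
  ∣u∣*∣u∣≡0⇒ u eq with m*n≡0⇒m≡0∨n≡0 ∣ u ∣ eq
  ... | inj₁ ∣u∣≡0 = ∣i∣≡0⇒i≡0 ∣u∣≡0
  ... | inj₂ ∣u∣≡0 = ∣i∣≡0⇒i≡0 ∣u∣≡0

  normSq-odd+even : ∀ t u →
    normSq ((+ 2 * t - + 1) +i (+ 2 * u)) ≡ + (1 ℕ.+ 4 ℕ.* (pronic t ℕ.+ ∣ u ∣ ℕ.* ∣ u ∣))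
  normSq-odd+even t u = begin
    normSq ((+ 2 * t - + 1) +i (+ 2 * u))
      ≡⟨ expand t u ⟩
    + 1 + + 4 * (t * (t - + 1) + u * u)
      ≡⟨ cong (λ x → + 1 + + 4 * x) (cong₂ _+_ (t[t-1]≡pronic t) (u*u≡∣u∣*∣u∣ u)) ⟩
    + 1 + + 4 * + (pronic t ℕ.+ ∣ u ∣ ℕ.* ∣ u ∣)
      ≡⟨ cong (_+_ (+ 1)) (pos-* 4 (pronic t ℕ.+ ∣ u ∣ ℕ.* ∣ u ∣)) ⟨
    + (1 ℕ.+ 4 ℕ.* (pronic t ℕ.+ ∣ u ∣ ℕ.* ∣ u ∣)) ∎
    where
    open ≡-Reasoning
    expand : ∀ t u → (+ 2 * t - + 1) * (+ 2 * t - + 1) + (+ 2 * u) * (+ 2 * u)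
                       ≡ + 1 + + 4 * (t * (t - + 1) + u * u)
    expand = solve-∀

  normSq-odd+even≡1⇔ : ∀ t u →
    normSq ((+ 2 * t - + 1) +i (+ 2 * u)) ≡ + 1 ⇔ ((t ≡ + 0 ⊎ t ≡ + 1) × u ≡ + 0)
  normSq-odd+even≡1⇔ t u = mk⇔ to from
    where
    to : normSq ((+ 2 * t - + 1) +i (+ 2 * u)) ≡ + 1 → (t ≡ + 0 ⊎ t ≡ + 1) × u ≡ + 0
    to eq with m*n≡0⇒m≡0∨n≡0 4 (suc-injective (+-injective (trans (sym (normSq-odd+even t u)) eq)))
    ... | inj₁ ()
    ... | inj₂ sum≡0 =
      pronic≡0⇒ t (m+n≡0⇒m≡0 _ sum≡0) , ∣u∣*∣u∣≡0⇒ u (m+n≡0⇒n≡0 _ sum≡0)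
    from : (t ≡ + 0 ⊎ t ≡ + 1) × u ≡ + 0 → normSq ((+ 2 * t - + 1) +i (+ 2 * u)) ≡ + 1
    from (inj₁ refl , refl) = refl
    from (inj₂ refl , refl) = refl

module QuaternaryAlphabet where

  open IntegerSums using (⟦_⟧; agree)
  open import Data.Bool using (Bool)
  open import Data.Integer using (+_; -_; _+_; _-_; _*_; _≟_)
  open import Data.Integer.Tactic.RingSolver using (solve-∀)
  open import Relation.Binary.PropositionalEquality
  open import Relation.Nullary using (does)

  inB inD : Q4 → Bool
  inB q = does (re (val q) - im (val q) ≟ - (+ 1))
  inD q = does (re (val q) + im (val q) ≟ - (+ 1))

  val≡ : ∀ q → val q ≡ (+ 1 - ⟦ inB q ⟧ - ⟦ inD q ⟧) +i (⟦ inB q ⟧ - ⟦ inD q ⟧)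
  val≡ q1 = refl
  val≡ qi = refl
  val≡ q-1 = refl
  val≡ q-i = refl

  re-val⊠conj : ∀ q q' →
    re (val q ⊠ conj (val q')) ≡ agree ⟦ inB q ⟧ ⟦ inB q' ⟧ + agree ⟦ inD q ⟧ ⟦ inD q' ⟧ - + 1
  re-val⊠conj q q' = trans (cong₂ (λ z z' → re (z ⊠ conj z')) (val≡ q) (val≡ q'))
                           (identity ⟦ inB q ⟧ ⟦ inD q ⟧ ⟦ inB q' ⟧ ⟦ inD q' ⟧)
    where
    identity : ∀ b d b' d' →
      (+ 1 - b - d) * (+ 1 - b' - d') - (b - d) * (- (b' - d'))
        ≡ (+ 1 - b - b' + + 2 * (b * b')) + (+ 1 - d - d' + + 2 * (d * d')) - + 1
    identity = solve-∀

  im-val⊠conj : ∀ q q' →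
    im (val q ⊠ conj (val q')) ≡ agree ⟦ inD q ⟧ ⟦ inB q' ⟧ - agree ⟦ inB q ⟧ ⟦ inD q' ⟧
  im-val⊠conj q q' = trans (cong₂ (λ z z' → im (z ⊠ conj z')) (val≡ q) (val≡ q'))
                           (identity ⟦ inB q ⟧ ⟦ inD q ⟧ ⟦ inB q' ⟧ ⟦ inD q' ⟧)
    where
    identity : ∀ b d b' d' →
      (+ 1 - b - d) * (- (b' - d')) + (b - d) * (+ 1 - b' - d')
        ≡ (+ 1 - d - b' + + 2 * (d * b')) - (+ 1 - b - d' + + 2 * (b * d'))
    identity = solve-∀

module IntegerArithmetic where

  open import Data.Integer using (+_; _+_; _-_; _*_)
  open import Data.Integer.Properties using (pos-+; pos-*; +-injective; i-j≡0⇒i≡j; i≡j⇒i-j≡0)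
  open import Data.Integer.Tactic.RingSolver using (solve-∀)
  open import Data.Nat as ℕ using ()
  open import Data.Nat.DivMod using (_%_; _/_; %-distribˡ-+; m*[n/m]≡n)
  open import Data.Nat.Divisibility using (_∣_; m%n≡0⇒n∣m)
  open import Function using (_∘_; _⇔_; mk⇔)
  open import Relation.Binary.PropositionalEquality

  odd⇒m≡2[m+1]/2-1 : ∀ m → m % 2 ≡ 1 → + m ≡ + 2 * + ((m ℕ.+ 1) / 2) - + 1
  odd⇒m≡2[m+1]/2-1 m odd = begin
    + m                             ≡⟨ add-sub (+ m) ⟩
    + m + + 1 - + 1                 ≡⟨ cong (_- + 1) (pos-+ m 1) ⟨
    + (m ℕ.+ 1) - + 1               ≡⟨ cong (λ n → + n - + 1) (m*[n/m]≡n 2∣m+1) ⟨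
    + (2 ℕ.* ((m ℕ.+ 1) / 2)) - + 1 ≡⟨ cong (_- + 1) (pos-* 2 ((m ℕ.+ 1) / 2)) ⟩
    + 2 * + ((m ℕ.+ 1) / 2) - + 1   ∎
    where
    open ≡-Reasoning
    2∣m+1 : 2 ∣ m ℕ.+ 1
    2∣m+1 = m%n≡0⇒n∣m (m ℕ.+ 1) 2 (trans (%-distribˡ-+ m 1 2) (cong (λ r → (r ℕ.+ 1 % 2) % 2) odd))
    add-sub : ∀ i → i ≡ i + + 1 - + 1
    add-sub = solve-∀

  i-j≡0⇔i≡j : ∀ {i j} → i - j ≡ + 0 ⇔ i ≡ j
  i-j≡0⇔i≡j {i} {j} = mk⇔ (i-j≡0⇒i≡j i j) i≡j⇒i-j≡0

  i-j≡1⇔i≡j+1 : ∀ {i j} → i - j ≡ + 1 ⇔ i ≡ j + + 1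
  i-j≡1⇔i≡j+1 {i} {j} =
    mk⇔ (λ eq → trans (sub-add i j) (cong (_+_ j) eq)) (λ eq → trans (cong (_- j) eq) (add-sub j))
    where
    sub-add : ∀ i j → i ≡ j + (i - j)
    sub-add = solve-∀
    add-sub : ∀ j → j + + 1 - j ≡ + 1
    add-sub = solve-∀

  +a-+b≡0⇔a≡b : ∀ {a b} → + a - + b ≡ + 0 ⇔ a ≡ b
  +a-+b≡0⇔a≡b {a} {b} =
    mk⇔ (+-injective ∘ i-j≡0⇒i≡j (+ a) (+ b)) (λ { refl → i≡j⇒i-j≡0 {+ a} refl })

module Autocorrelation (m : ℕ) .{{_ : NonZero m}} (f : Fin m → Q4) where

  open IntegerSums
  open Residues m
  open GaussianIntegers using (re-foldr-⊞; im-foldr-⊞; normSq-odd+even≡1⇔)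
  open QuaternaryAlphabet
  open IntegerArithmetic
  open import Data.Bool using (Bool)
  open import Data.Fin.Subset using (Subset; ∣_∣)
  open import Data.Integer using (ℤ; +_; _+_; _-_; _*_)
  open import Data.Integer.Tactic.RingSolver using (solve-∀)
  open import Data.Nat as ℕ using ()
  open import Data.Nat.DivMod using (_%_; _/_)
  open import Data.Product using (_×_)
  open import Data.Product.Function.NonDependent.Propositional using (_×-⇔_)
  open import Data.Sum using (_⊎_)
  open import Data.Sum.Function.Propositional using (_⊎-⇔_)
  open import Function using (_∘_; id; _⇔_; mk⇔)
  open import Function.Properties.Equivalence using () renaming (trans to ⇔-trans)
  open import Relation.Binary.PropositionalEquality

  β δ : Fin m → Bool
  β = inB ∘ f
  δ = inD ∘ f

  B D : Subset m
  B = Bset m f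
  D = Dset m f

  μ : ℤ
  μ = (+ ∣ B ∣ + + ∣ D ∣) - + ((m ℕ.+ 1) / 2)

  excess asymmetry : Fin m → ℤ
  excess w = + N m B D w - μ
  asymmetry w = + pairDiffCount m B D w - + pairDiffCount m B D (-ₘ w)

  re-R : ∀ w → re (R m f w) ≡ + m - + 2 * (+ ∣ B ∣ + + ∣ D ∣) + + 2 * + N m B D w
  re-R w = begin
    re (R m f w)
      ≡⟨ re-foldr-⊞ (λ k → val (f k) ⊠ conj (val (f (k +ₘ w)))) id ⟩
    sum (λ k → re (val (f k) ⊠ conj (val (f (k +ₘ w)))))
      ≡⟨ sum-cong-≗ (λ k → re-val⊠conj (f k) (f (k +ₘ w))) ⟩
    sum (λ k → agreeβ k + agreeδ k - + 1)
      ≡⟨ ∑[g-h]≡∑g-∑h (λ k → agreeβ k + agreeδ k) (λ _ → + 1) ⟩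
    sum (λ k → agreeβ k + agreeδ k) - sum {m} (λ _ → + 1)
      ≡⟨ cong₂ _-_ (∑-distrib-+ agreeβ agreeδ) (sum-const m (+ 1)) ⟩
    sum agreeβ + sum agreeδ - + m * + 1
      ≡⟨ cong₂ (λ x y → x + y - + m * + 1)
               (∑-agree-translate β β w) (∑-agree-translate δ δ w) ⟩
    (+ m - b - b + + 2 * correlation β β w) + (+ m - d - d + + 2 * correlation δ δ w) - + m * + 1
      ≡⟨ cong₂ (λ x y → (+ m - b - b + + 2 * x) + (+ m - d - d + + 2 * y) - + m * + 1)
               (sym (pairDiffCount-tabulate β β w)) (sym (pairDiffCount-tabulate δ δ w)) ⟩
    (+ m - b - b + + 2 * nBB) + (+ m - d - d + + 2 * nDD) - + m * + 1
      ≡⟨ collect (+ m) b d nBB nDD ⟩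
    + m - + 2 * (b + d) + + 2 * (nBB + nDD) ∎
    where
    open ≡-Reasoning
    agreeβ agreeδ : Fin m → ℤ
    agreeβ k = agree ⟦ β k ⟧ ⟦ β (k +ₘ w) ⟧
    agreeδ k = agree ⟦ δ k ⟧ ⟦ δ (k +ₘ w) ⟧
    b d nBB nDD : ℤ
    b = + ∣ B ∣
    d = + ∣ D ∣
    nBB = + pairDiffCount m B B w
    nDD = + pairDiffCount m D D w
    collect : ∀ m b d p q →
      (m - b - b + + 2 * p) + (m - d - d + + 2 * q) - m * + 1 ≡ m - + 2 * (b + d) + + 2 * (p + q)
    collect = solve-∀

  im-R : ∀ w → im (R m f w) ≡ + 2 * asymmetry w
  im-R w = begin
    im (R m f w)
      ≡⟨ im-foldr-⊞ (λ k → val (f k) ⊠ conj (val (f (k +ₘ w)))) id ⟩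
    sum (λ k → im (val (f k) ⊠ conj (val (f (k +ₘ w)))))
      ≡⟨ sum-cong-≗ (λ k → im-val⊠conj (f k) (f (k +ₘ w))) ⟩
    sum (λ k → agreeδβ k - agreeβδ k)
      ≡⟨ ∑[g-h]≡∑g-∑h agreeδβ agreeβδ ⟩
    sum agreeδβ - sum agreeβδ
      ≡⟨ cong₂ _-_ (∑-agree-translate δ β w) (∑-agree-translate β δ w) ⟩
    (+ m - d - b + + 2 * correlation δ β w) - (+ m - b - d + + 2 * correlation β δ w)
      ≡⟨ cancel (+ m) b d (correlation δ β w) (correlation β δ w) ⟩
    + 2 * (correlation δ β w - correlation β δ w)
      ≡⟨ cong₂ (λ x y → + 2 * (x - y))
               (sym (pairDiffCount-tabulate β δ w))
               (trans (sym (correlation-neg β δ w)) (sym (pairDiffCount-tabulate β δ (-ₘ w)))) ⟩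
    + 2 * asymmetry w ∎
    where
    open ≡-Reasoning
    agreeδβ agreeβδ : Fin m → ℤ
    agreeδβ k = agree ⟦ δ k ⟧ ⟦ β (k +ₘ w) ⟧
    agreeβδ k = agree ⟦ β k ⟧ ⟦ δ (k +ₘ w) ⟧
    b d : ℤ
    b = + ∣ B ∣
    d = + ∣ D ∣
    cancel : ∀ m b d p q → (m - d - b + + 2 * p) - (m - b - d + + 2 * q) ≡ + 2 * (p - q)
    cancel = solve-∀

  R≡ : m % 2 ≡ 1 → ∀ w → R m f w ≡ (+ 2 * excess w - + 1) +i (+ 2 * asymmetry w)
  R≡ odd w = cong₂ _+i_ re-part (im-R w)
    where
    open ≡-Reasoning
    regroup : ∀ h b d n → + 2 * h - + 1 - + 2 * (b + d) + + 2 * n ≡ + 2 * (n - (b + d - h)) - + 1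
    regroup = solve-∀
    re-part : re (R m f w) ≡ + 2 * excess w - + 1
    re-part = begin
      re (R m f w)
        ≡⟨ re-R w ⟩
      + m - + 2 * (+ ∣ B ∣ + + ∣ D ∣) + + 2 * + N m B D w
        ≡⟨ cong (λ x → x - + 2 * (+ ∣ B ∣ + + ∣ D ∣) + + 2 * + N m B D w)
                (odd⇒m≡2[m+1]/2-1 m odd) ⟩
      + 2 * + ((m ℕ.+ 1) / 2) - + 1 - + 2 * (+ ∣ B ∣ + + ∣ D ∣) + + 2 * + N m B D w
        ≡⟨ regroup (+ ((m ℕ.+ 1) / 2)) (+ ∣ B ∣) (+ ∣ D ∣) (+ N m B D w) ⟩
      + 2 * excess w - + 1 ∎

  normSq-R≡1⇔ : m % 2 ≡ 1 → ∀ w →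
    normSq (R m f w) ≡ + 1 ⇔
      ((+ N m B D w ≡ μ ⊎ + N m B D w ≡ μ + + 1)
        × pairDiffCount m B D w ≡ pairDiffCount m B D (-ₘ w))
  normSq-R≡1⇔ odd w =
    ⇔-trans (mk⇔ (trans (sym normSq-R≡)) (trans normSq-R≡))
      (⇔-trans (normSq-odd+even≡1⇔ (excess w) (asymmetry w))
               ((i-j≡0⇔i≡j ⊎-⇔ i-j≡1⇔i≡j+1 {j = μ}) ×-⇔ +a-+b≡0⇔a≡b))
    where
    normSq-R≡ : normSq (R m f w) ≡ normSq ((+ 2 * excess w - + 1) +i (+ 2 * asymmetry w))
    normSq-R≡ = cong normSq (R≡ odd w)

open import Data.Nat using (_+_; _/_)
open import Data.Nat.DivMod using (_%_)
open import Data.Integer using (+_; _-_)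
open import Data.Fin.Properties using (_≟_)
open import Data.Fin.Subset using (∣_∣)
open import Data.Product using (_×_; _,_; proj₁; proj₂)
open import Function.Bundles using (_⇔_; mk⇔; Equivalence)
open import Relation.Binary.PropositionalEquality using (_≡_; refl; cong; sym)
open import Relation.Nullary using (yes; no)

theorem3 : (m : ℕ) .{{_ : NonZero m}} → m % 2 ≡ 1 → (f : Fin m → Q4) →
  OQS m f ⇔
    (ASDS m (Bset m f) (Dset m f) ∣ Bset m f ∣ ∣ Dset m f ∣
        ((+ ∣ Bset m f ∣ Data.Integer.+ + ∣ Dset m f ∣) - + ((m + 1) / 2))
      × SymmetricDiff m (Bset m f) (Dset m f))
theorem3 m odd f = mk⇔
  (λ oqs → (refl , refl , λ a a≢0 → proj₁ (to a (oqs a a≢0))) , symmetric oqs)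
  (λ { ((_ , _ , near) , symm) w w≢0 → from w (near w w≢0 , symm w) })
  where
  open Residues m using (-0≡0)
  open module OQS-at (w : Fin m) = Equivalence (Autocorrelation.normSq-R≡1⇔ m f odd w) using (to; from)
  symmetric : OQS m f → SymmetricDiff m (Bset m f) (Dset m f)
  symmetric oqs w with w ≟ 0m m
  ... | yes refl = cong (pairDiffCount m (Bset m f) (Dset m f)) (sym -0≡0)
  ... | no w≢0 = proj₂ (to w (oqs w w≢0))
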